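{- For a positive integer $n$ let $F(n)=\sum_{k=1}^{n}\frac{(k,n)}{[k,n]}$. Then, as $x\to\infty$, $$\sum_{n\le x}F(n)=2x+O\left((\log x)^2\right),$$ and $$\sum_{m,n\le x}\frac{(m,n)}{[m,n]}=3x+O\left((\log x)^2\right).$$
   Context: $(a,b)$ and $[a,b]$ denote the greatest common divisor and least common multiple of positive integers $a,b$; sums range over positive integers. -}

module Defs where

open import Data.Nat using (ℕ; zero; suc)
open import Data.Nat.GCD using (gcd)
open import Data.Nat.LCM using (lcm)
open import Data.Integer using (+_)
open import Data.Rational using (ℚ; 0ℚ; _/_; _+_)

-- (a,b)/[a,b] as a rational number (a, b positive; lcm of positives is nonzero,
-- the zero branch is only reached when a or b is 0 and is never used)
gcdOverLcm : ℕ → ℕ → ℚ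
gcdOverLcm a b with lcm a b
... | zero  = 0ℚ
... | suc l = (+ gcd a b) / suc l

sum1to : ℕ → (ℕ → ℚ) → ℚ
sum1to zero    f = 0ℚ
sum1to (suc n) f = sum1to n f + f (suc n)

F : ℕ → ℚ
F n = sum1to n (λ k → gcdOverLcm k n)

sumF : ℕ → ℚ
sumF N = sum1to N F

doubleSum : ℕ → ℚ
doubleSum N = sum1to N (λ m → sum1to N (λ n → gcdOverLcm m n))

module Submission where

-- Writing k = d a and n = d b with d = (k, n) gives (k, n)/[k, n] = 1/(ab) with (a, b) = 1, so
-- F(n) = Σ_{b ∣ n} r(b) with r(b) = Σ_{a ≤ b, (a,b) = 1} 1/(ab), and Σ_{n ≤ N} F(n) = Σ_{b ≤ N} ⌊N/b⌋ r(b).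
-- As r(b) = b p(b) with p(b) = Σ_{a ≤ b, (a,b) = 1} 1/(ab²), this is N Σ_{b ≤ N} p(b) up to an error
-- Σ_{b ≤ N} r(b) ≤ H(N)², where H is the harmonic sum. The constant is Σ_b p(b) = 2, proved finitely
-- on the tree of coprime pairs generated by (a, b) ↦ (a, a + b), (b, a + b): the partial sum up to N
-- plus the weight of the subtrees hanging just beyond N is always 2, and that weight is at most
-- 3 H(N)/N. Finally H(N) ≤ log₂ N + 1, and by symmetry the double sum is 2 Σ_{n ≤ N} F(n) − N.

module Estimates where

  open import Data.Nat as ℕ using (ℕ; zero; suc; NonZero; z≤n; s≤s)
  import Data.Nat.Properties as ℕ
  open import Data.Nat.Divisibility
    using (_∣_; divides; _∣?_; ∣⇒≤; ∣m+n∣m⇒∣n; m∣m*n; ∣m∣n⇒∣m+n; ∣-refl; ∣-antisym)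
  open import Data.Nat.GCD
    using (gcd; gcd[m,n]∣m; gcd[m,n]∣n; gcd[m,n]≢0; gcd-greatest; gcd-comm; c*gcd[m,n]≡gcd[cm,cn])
  open import Data.Nat.LCM using (lcm; gcd*lcm; lcm-comm)
  open import Data.Nat.Logarithm using (⌊log₂_⌋; ⌊log₂⌋-mono-≤; ⌊log₂⌊n/2⌋⌋≡⌊log₂n⌋∸1)
  open import Data.Nat.Solver using (module +-*-Solver)
  open import Data.Nat.Induction using (<-rec)
  import Data.Integer as ℤ
  import Data.Integer.Properties as ℤ
  open import Data.Rational hiding (NonZero)
  open import Data.Rational.Properties
  import Data.Rational.Unnormalised as ℚᵘ
  import Data.Rational.Unnormalised.Properties as ℚᵘ
  open import Algebra.Solver.Ring.AlmostCommutativeRing using (fromCommutativeRing)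
  import Algebra.Solver.Ring.Simple as RingSolver
  open import Algebra.Properties.AbelianGroup +-0-abelianGroup using (∙-cancelʳ)
  open import Data.Product using (_,_; _×_; proj₁; proj₂)
  open import Data.Sum using (inj₂)
  open import Relation.Nullary using (Dec; yes; no; ¬_; contradiction)
  open import Relation.Binary.PropositionalEquality
  open import Function using (_∘_)

  open import Defs

  module ℕ-Solver = +-*-Solver
  module ℚ-Solver = RingSolver (fromCommutativeRing +-*-commutativeRing) _≟_

  frac : ℕ → (b : ℕ) → .{{NonZero b}} → ℚ
  frac a b = ℤ.+ a / b

  private
    +-*-+ : ∀ a b → ℤ.+ a ℤ.* ℤ.+ b ≡ ℤ.+ (a ℕ.* b)
    +-*-+ a b = ℤ.+◃n≡+n (a ℕ.* b)

    frac≃ : ∀ a b .{{_ : NonZero b}} → toℚᵘ (frac a b) ℚᵘ.≃ (ℤ.+ a) ℚᵘ./ b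
    frac≃ a (suc b) = toℚᵘ-fromℚᵘ (ℚᵘ.mkℚᵘ (ℤ.+ a) b)

  frac-≡ : ∀ a b c d .{{_ : NonZero b}} .{{_ : NonZero d}} →
           a ℕ.* d ≡ c ℕ.* b → frac a b ≡ frac c d
  frac-≡ a b@(suc _) c d@(suc _) eq = toℚᵘ-injective (ℚᵘ.≃-trans (frac≃ a b)
    (ℚᵘ.≃-trans (ℚᵘ.*≡* (trans (+-*-+ a d) (trans (cong ℤ.+_ eq) (sym (+-*-+ c b)))))
                (ℚᵘ.≃-sym (frac≃ c d))))

  frac-≤ : ∀ a b c d .{{_ : NonZero b}} .{{_ : NonZero d}} →
           a ℕ.* d ℕ.≤ c ℕ.* b → frac a b ≤ frac c d
  frac-≤ a b@(suc _) c d@(suc _) le = toℚᵘ-cancel-≤ (ℚᵘ.≤-respˡ-≃ (ℚᵘ.≃-sym (frac≃ a b))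
    (ℚᵘ.≤-respʳ-≃ (ℚᵘ.≃-sym (frac≃ c d))
      (ℚᵘ.*≤* (subst₂ ℤ._≤_ (sym (+-*-+ a d)) (sym (+-*-+ c b)) (ℤ.+≤+ le)))))

  frac-+ : ∀ a b c d .{{_ : NonZero b}} .{{_ : NonZero d}} →
           frac a b + frac c d ≡ frac (a ℕ.* d ℕ.+ c ℕ.* b) (b ℕ.* d) {{ℕ.m*n≢0 b d}}
  frac-+ a b@(suc _) c d@(suc _) = toℚᵘ-injective (ℚᵘ.≃-trans (toℚᵘ-homo-+ (frac a b) (frac c d))
    (ℚᵘ.≃-trans (ℚᵘ.+-cong (frac≃ a b) (frac≃ c d))
    (ℚᵘ.≃-trans (ℚᵘ.*≡* (cong (ℤ._* ℤ.+ (b ℕ.* d)) numerator))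
                (ℚᵘ.≃-sym (frac≃ (a ℕ.* d ℕ.+ c ℕ.* b) (b ℕ.* d))))))
    where
    numerator : ℤ.+ a ℤ.* ℤ.+ d ℤ.+ ℤ.+ c ℤ.* ℤ.+ b ≡ ℤ.+ (a ℕ.* d ℕ.+ c ℕ.* b)
    numerator = trans (cong₂ ℤ._+_ (+-*-+ a d) (+-*-+ c b)) (sym (ℤ.pos-+ (a ℕ.* d) (c ℕ.* b)))

  frac-* : ∀ a b c d .{{_ : NonZero b}} .{{_ : NonZero d}} →
           frac a b * frac c d ≡ frac (a ℕ.* c) (b ℕ.* d) {{ℕ.m*n≢0 b d}}
  frac-* a b@(suc _) c d@(suc _) = toℚᵘ-injective (ℚᵘ.≃-trans (toℚᵘ-homo-* (frac a b) (frac c d))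
    (ℚᵘ.≃-trans (ℚᵘ.*-cong (frac≃ a b) (frac≃ c d))
    (ℚᵘ.≃-trans (ℚᵘ.*≡* (cong (ℤ._* ℤ.+ (b ℕ.* d)) (+-*-+ a c)))
                (ℚᵘ.≃-sym (frac≃ (a ℕ.* c) (b ℕ.* d))))))

  ι : ℕ → ℚ
  ι n = frac n 1

  -- recip 0 = 0 matches the junk value of gcdOverLcm at 0, so gcdOverLcm≡ holds unconditionally.
  recip : ℕ → ℚ
  recip zero    = 0ℚ
  recip (suc n) = frac 1 (suc n)

  ι-+ : ∀ m n → ι (m ℕ.+ n) ≡ ι m + ι n
  ι-+ m n = trans (frac-≡ (m ℕ.+ n) 1 (m ℕ.* 1 ℕ.+ n ℕ.* 1) 1
    (solve 2 (λ m n → (m :+ n) :* con 1 := (m :* con 1 :+ n :* con 1) :* con 1) refl m n))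
    (sym (frac-+ m 1 n 1))
    where open ℕ-Solver

  ι-* : ∀ m n → ι (m ℕ.* n) ≡ ι m * ι n
  ι-* m n = sym (frac-* m 1 n 1)

  ι-mono-≤ : ∀ {m n} → m ℕ.≤ n → ι m ≤ ι n
  ι-mono-≤ {m} {n} m≤n = frac-≤ m 1 n 1 (ℕ.*-monoˡ-≤ 1 m≤n)

  ι-nonNeg : ∀ n → 0ℚ ≤ ι n
  ι-nonNeg n = ι-mono-≤ {0} {n} z≤n

  ι*recip : ∀ n .{{_ : NonZero n}} → ι n * recip n ≡ 1ℚ
  ι*recip n@(suc _) = trans (frac-* n 1 1 n) (frac-≡ (n ℕ.* 1) (1 ℕ.* n) 1 1
    (solve 1 (λ n → n :* con 1 :* con 1 := con 1 :* (con 1 :* n)) refl n))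
    where open ℕ-Solver

  recip-* : ∀ m n → recip (m ℕ.* n) ≡ recip m * recip n
  recip-* zero        n         = sym (*-zeroˡ (recip n))
  recip-* (suc m)     zero      = trans (cong recip (ℕ.*-zeroʳ m)) (sym (*-zeroʳ (recip (suc m))))
  recip-* m@(suc _) n@(suc _) = sym (frac-* 1 m 1 n)

  recip-antitone : ∀ {m n} .{{_ : NonZero m}} → m ℕ.≤ n → recip n ≤ recip m
  recip-antitone {m@(suc _)} {n@(suc _)} m≤n = frac-≤ 1 n 1 m (ℕ.*-monoʳ-≤ 1 m≤n)

  recip-nonNeg : ∀ n → 0ℚ ≤ recip n
  recip-nonNeg zero    = ≤-refl
  recip-nonNeg (suc n) = frac-≤ 0 1 1 (suc n) z≤n

  *-nonNeg : ∀ {p q} → 0ℚ ≤ p → 0ℚ ≤ q → 0ℚ ≤ p * q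
  *-nonNeg {p} {q} 0≤p 0≤q = subst (_≤ p * q) (*-zeroʳ p) (*-monoˡ-≤-nonNeg p {{nonNegative 0≤p}} 0≤q)

  +-nonNeg : ∀ {p q} → 0ℚ ≤ p → 0ℚ ≤ q → 0ℚ ≤ p + q
  +-nonNeg = +-mono-≤

  *-mono-≤-nonNeg : ∀ {p q r s} → 0ℚ ≤ p → 0ℚ ≤ r → p ≤ q → r ≤ s → p * r ≤ q * s
  *-mono-≤-nonNeg {p} {q} {r} {s} 0≤p 0≤r p≤q r≤s = ≤-trans
    (*-monoʳ-≤-nonNeg r {{nonNegative 0≤r}} p≤q)
    (*-monoˡ-≤-nonNeg q {{nonNegative (≤-trans 0≤p p≤q)}} r≤s)

  gcdOverLcm≡ : ∀ a b → gcdOverLcm a b ≡ ι (gcd a b) * recip (lcm a b)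
  gcdOverLcm≡ a b with lcm a b
  ... | zero  = sym (*-zeroʳ (ι (gcd a b)))
  ... | suc l = sym (trans (frac-* (gcd a b) 1 1 (suc l))
                           (frac-≡ (gcd a b ℕ.* 1) (1 ℕ.* suc l) (gcd a b) (suc l)
                             (ℕ.*-assoc (gcd a b) 1 (suc l))))

  sum-cong : ∀ n {f g : ℕ → ℚ} → (∀ j → 1 ℕ.≤ j → j ℕ.≤ n → f j ≡ g j) → sum1to n f ≡ sum1to n g
  sum-cong zero    f≗g = refl
  sum-cong (suc n) f≗g = cong₂ _+_ (sum-cong n (λ j 1≤j j≤n → f≗g j 1≤j (ℕ.m≤n⇒m≤1+n j≤n)))
                                   (f≗g (suc n) (s≤s z≤n) ℕ.≤-refl)

  sum-mono : ∀ n {f g : ℕ → ℚ} → (∀ j → 1 ℕ.≤ j → j ℕ.≤ n → f j ≤ g j) → sum1to n f ≤ sum1to n g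
  sum-mono zero    f≤g = ≤-refl
  sum-mono (suc n) f≤g = +-mono-≤ (sum-mono n (λ j 1≤j j≤n → f≤g j 1≤j (ℕ.m≤n⇒m≤1+n j≤n)))
                                  (f≤g (suc n) (s≤s z≤n) ℕ.≤-refl)

  sum-zero : ∀ n → sum1to n (λ _ → 0ℚ) ≡ 0ℚ
  sum-zero zero    = refl
  sum-zero (suc n) = trans (+-identityʳ _) (sum-zero n)

  sum-nonNeg : ∀ n {f : ℕ → ℚ} → (∀ j → 1 ℕ.≤ j → j ℕ.≤ n → 0ℚ ≤ f j) → 0ℚ ≤ sum1to n f
  sum-nonNeg n {f} 0≤f = subst (_≤ sum1to n f) (sum-zero n) (sum-mono n 0≤f)

  sum-+ : ∀ n (f g : ℕ → ℚ) → sum1to n (λ j → f j + g j) ≡ sum1to n f + sum1to n g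
  sum-+ zero    f g = refl
  sum-+ (suc n) f g = trans (cong (_+ (f (suc n) + g (suc n))) (sum-+ n f g))
    (solve 4 (λ a b c d → (a :+ b) :+ (c :+ d) := (a :+ c) :+ (b :+ d)) refl
      (sum1to n f) (sum1to n g) (f (suc n)) (g (suc n)))
    where open ℚ-Solver

  sum-*ˡ : ∀ n (c : ℚ) (f : ℕ → ℚ) → sum1to n (λ j → c * f j) ≡ c * sum1to n f
  sum-*ˡ zero    c f = sym (*-zeroʳ c)
  sum-*ˡ (suc n) c f = trans (cong (_+ (c * f (suc n))) (sum-*ˡ n c f))
                             (sym (*-distribˡ-+ c (sum1to n f) (f (suc n))))

  sum-const : ∀ n (x : ℚ) → sum1to n (λ _ → x) ≡ ι n * x
  sum-const zero    x = sym (*-zeroˡ x)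
  sum-const (suc n) x = trans (cong (_+ x) (sum-const n x))
    (trans (solve 2 (λ a x → a :* x :+ x := (con 1ℚ :+ a) :* x) refl (ι n) x)
           (cong (_* x) (sym (ι-+ 1 n))))
    where open ℚ-Solver

  sum-comm : ∀ m n (f : ℕ → ℕ → ℚ) →
             sum1to m (λ i → sum1to n (λ j → f i j)) ≡ sum1to n (λ j → sum1to m (λ i → f i j))
  sum-comm zero    n f = sym (sum-zero n)
  sum-comm (suc m) n f = trans (cong (_+ sum1to n (f (suc m))) (sum-comm m n f))
                               (sym (sum-+ n (λ j → sum1to m (λ i → f i j)) (f (suc m))))

  sum-split : ∀ m n (f : ℕ → ℚ) → sum1to (m ℕ.+ n) f ≡ sum1to m f + sum1to n (λ j → f (m ℕ.+ j))
  sum-split m zero    f = trans (cong (λ k → sum1to k f) (ℕ.+-identityʳ m)) (sym (+-identityʳ _))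
  sum-split m (suc n) f = begin
      sum1to (m ℕ.+ suc n) f
    ≡⟨ cong (λ k → sum1to k f) (ℕ.+-suc m n) ⟩
      sum1to (m ℕ.+ n) f + f (suc (m ℕ.+ n))
    ≡⟨ cong₂ _+_ (sum-split m n f) (cong f (sym (ℕ.+-suc m n))) ⟩
      (sum1to m f + sum1to n (λ j → f (m ℕ.+ j))) + f (m ℕ.+ suc n)
    ≡⟨ +-assoc (sum1to m f) _ _ ⟩
      sum1to m f + sum1to (suc n) (λ j → f (m ℕ.+ j))
    ∎
    where open ≡-Reasoning

  sum-extend : ∀ {m n} {f : ℕ → ℚ} → m ℕ.≤ n → (∀ j → 1 ℕ.≤ j → 0ℚ ≤ f j) → sum1to m f ≤ sum1to n f
  sum-extend {m} {n} {f} m≤n 0≤f = begin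
      sum1to m f
    ≡⟨ sym (+-identityʳ (sum1to m f)) ⟩
      sum1to m f + 0ℚ
    ≤⟨ +-monoʳ-≤ (sum1to m f) (sum-nonNeg (n ℕ.∸ m) (λ j 1≤j _ → 0≤f (m ℕ.+ j) (ℕ.≤-trans 1≤j (ℕ.m≤n+m j m)))) ⟩
      sum1to m f + sum1to (n ℕ.∸ m) (λ j → f (m ℕ.+ j))
    ≡⟨ sym (sum-split m (n ℕ.∸ m) f) ⟩
      sum1to (m ℕ.+ (n ℕ.∸ m)) f
    ≡⟨ cong (λ k → sum1to k f) (ℕ.m+[n∸m]≡n m≤n) ⟩
      sum1to n f
    ∎
    where open ≤-Reasoning

  when : {P : Set} → Dec P → ℚ → ℚ
  when (yes _) x = x
  when (no _)  _ = 0ℚ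

  when-yes : ∀ {P : Set} (P? : Dec P) {x} → P → when P? x ≡ x
  when-yes (yes _) p = refl
  when-yes (no ¬p) p = contradiction p ¬p

  when-no : ∀ {P : Set} (P? : Dec P) {x} → ¬ P → when P? x ≡ 0ℚ
  when-no (yes p) ¬p = contradiction p ¬p
  when-no (no _)  ¬p = refl

  when-cong : ∀ {P Q : Set} (P? : Dec P) (Q? : Dec Q) {x y} →
              (P → Q) → (Q → P) → (P → x ≡ y) → when P? x ≡ when Q? y
  when-cong (yes p) (yes q) P⇒Q Q⇒P x≡y = x≡y p
  when-cong (yes p) (no ¬q) P⇒Q Q⇒P x≡y = contradiction (P⇒Q p) ¬q
  when-cong (no ¬p) (yes q) P⇒Q Q⇒P x≡y = contradiction (Q⇒P q) ¬p
  when-cong (no _)  (no _)  P⇒Q Q⇒P x≡y = refl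

  *-when : ∀ {P : Set} (P? : Dec P) c x → c * when P? x ≡ when P? (c * x)
  *-when (yes _) c x = refl
  *-when (no _)  c x = *-zeroʳ c

  when-nonNeg : ∀ {P : Set} (P? : Dec P) {x} → 0ℚ ≤ x → 0ℚ ≤ when P? x
  when-nonNeg (yes _) 0≤x = 0≤x
  when-nonNeg (no _)  0≤x = ≤-refl

  when-≤ : ∀ {P : Set} (P? : Dec P) {x} → 0ℚ ≤ x → when P? x ≤ x
  when-≤ (yes _) 0≤x = ≤-refl
  when-≤ (no _)  0≤x = 0≤x

  sum-when-≡ : ∀ n k x → 1 ℕ.≤ k → k ℕ.≤ n → sum1to n (λ j → when (j ℕ.≟ k) x) ≡ x
  sum-when-≡ zero    k x 1≤k k≤0 = contradiction (ℕ.≤-trans 1≤k k≤0) λ ()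
  sum-when-≡ (suc n) k x 1≤k k≤n with k ℕ.≟ suc n
  ... | yes refl = begin
      sum1to n (λ j → when (j ℕ.≟ suc n) x) + when (suc n ℕ.≟ suc n) x
    ≡⟨ cong₂ _+_ (trans (sum-cong n (λ j _ j≤n → when-no (j ℕ.≟ suc n) (ℕ.<⇒≢ (s≤s j≤n)))) (sum-zero n))
                 (when-yes (suc n ℕ.≟ suc n) refl) ⟩
      0ℚ + x
    ≡⟨ +-identityˡ x ⟩
      x
    ∎
    where open ≡-Reasoning
  ... | no k≢1+n =
    trans (cong (λ t → sum1to n (λ j → when (j ℕ.≟ k) x) + t) (when-no (suc n ℕ.≟ k) (k≢1+n ∘ sym)))
          (trans (+-identityʳ _) (sum-when-≡ n k x 1≤k (ℕ.≤-pred (ℕ.≤∧≢⇒< k≤n k≢1+n))))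

  gcd[n,n]≡n : ∀ n → gcd n n ≡ n
  gcd[n,n]≡n n = ∣-antisym (gcd[m,n]∣m n n) (gcd-greatest ∣-refl ∣-refl)

  gcd[m,n+m]≡gcd[m,n] : ∀ m n → gcd m (n ℕ.+ m) ≡ gcd m n
  gcd[m,n+m]≡gcd[m,n] m n = ∣-antisym
    (gcd-greatest (gcd[m,n]∣m m (n ℕ.+ m))
      (∣m+n∣m⇒∣n (subst (gcd m (n ℕ.+ m) ∣_) (ℕ.+-comm n m) (gcd[m,n]∣n m (n ℕ.+ m)))
                 (gcd[m,n]∣m m (n ℕ.+ m))))
    (gcd-greatest (gcd[m,n]∣m m n) (∣m∣n⇒∣m+n (gcd[m,n]∣n m n) (gcd[m,n]∣m m n)))

  gcd[n,n+m]≡gcd[m,n] : ∀ m n → gcd n (n ℕ.+ m) ≡ gcd m n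
  gcd[n,n+m]≡gcd[m,n] m n =
    trans (cong (gcd n) (ℕ.+-comm n m)) (trans (gcd[m,n+m]≡gcd[m,n] n m) (gcd-comm n m))

  gcdOverLcm-comm : ∀ a b → gcdOverLcm a b ≡ gcdOverLcm b a
  gcdOverLcm-comm a b = trans (gcdOverLcm≡ a b)
    (trans (cong₂ (λ g l → ι g * recip l) (gcd-comm a b) (lcm-comm a b)) (sym (gcdOverLcm≡ b a)))

  gcdOverLcm[n,n]≡1 : ∀ n .{{_ : NonZero n}} → gcdOverLcm n n ≡ 1ℚ
  gcdOverLcm[n,n]≡1 n = trans (gcdOverLcm≡ n n)
    (trans (cong₂ (λ g l → ι g * recip l) (gcd[n,n]≡n n) lcm[n,n]≡n) (ι*recip n))
    where
    lcm[n,n]≡n : lcm n n ≡ n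
    lcm[n,n]≡n = ℕ.*-cancelˡ-≡ (lcm n n) n n
      (trans (cong (ℕ._* lcm n n) (sym (gcd[n,n]≡n n))) (gcd*lcm n n))

  [_⊥_]_ : ℕ → ℕ → ℚ → ℚ
  [ a ⊥ b ] x = when (gcd a b ℕ.≟ 1) x

  coprimeSum : ℕ → ℚ
  coprimeSum b = sum1to b (λ a → [ a ⊥ b ] (recip a * recip b))

  gcdOverLcm-scale : ∀ d .{{_ : NonZero d}} a b →
    when (gcd (d ℕ.* a) (d ℕ.* b) ℕ.≟ d) (gcdOverLcm (d ℕ.* a) (d ℕ.* b)) ≡ [ a ⊥ b ] (recip a * recip b)
  gcdOverLcm-scale d@(suc _) a b = when-cong (gcd (d ℕ.* a) (d ℕ.* b) ℕ.≟ d) (gcd a b ℕ.≟ 1)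
    (λ gcd≡d → ℕ.*-cancelˡ-≡ (gcd a b) 1 d (trans gcd[da,db]≡d*gcd (trans gcd≡d (sym (ℕ.*-identityʳ d)))))
    (λ gcd≡1 → trans (sym gcd[da,db]≡d*gcd) (trans (cong (d ℕ.*_) gcd≡1) (ℕ.*-identityʳ d)))
    value
    where
    gcd[da,db]≡d*gcd : d ℕ.* gcd a b ≡ gcd (d ℕ.* a) (d ℕ.* b)
    gcd[da,db]≡d*gcd = c*gcd[m,n]≡gcd[cm,cn] d a b
    value : gcd (d ℕ.* a) (d ℕ.* b) ≡ d → gcdOverLcm (d ℕ.* a) (d ℕ.* b) ≡ recip a * recip b
    value gcd≡d = begin
        gcdOverLcm (d ℕ.* a) (d ℕ.* b)
      ≡⟨ gcdOverLcm≡ (d ℕ.* a) (d ℕ.* b) ⟩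
        ι (gcd (d ℕ.* a) (d ℕ.* b)) * recip (lcm (d ℕ.* a) (d ℕ.* b))
      ≡⟨ cong₂ (λ g l → ι g * recip l) gcd≡d lcm≡ ⟩
        ι d * recip (d ℕ.* (a ℕ.* b))
      ≡⟨ cong (ι d *_) (trans (recip-* d (a ℕ.* b)) (cong (recip d *_) (recip-* a b))) ⟩
        ι d * (recip d * (recip a * recip b))
      ≡⟨ sym (*-assoc (ι d) (recip d) _) ⟩
        ι d * recip d * (recip a * recip b)
      ≡⟨ trans (cong (_* (recip a * recip b)) (ι*recip d)) (*-identityˡ _) ⟩
        recip a * recip b
      ∎
      where
      open ≡-Reasoning
      lcm≡ : lcm (d ℕ.* a) (d ℕ.* b) ≡ d ℕ.* (a ℕ.* b)
      lcm≡ = ℕ.*-cancelˡ-≡ _ _ d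
        (trans (cong (ℕ._* lcm (d ℕ.* a) (d ℕ.* b)) (sym gcd≡d))
        (trans (gcd*lcm (d ℕ.* a) (d ℕ.* b))
               (solve 3 (λ d a b → (d :* a) :* (d :* b) := d :* (d :* (a :* b))) refl d a b)))
        where open ℕ-Solver

  sum-multiples : ∀ d .{{_ : NonZero d}} b (f : ℕ → ℚ) →
                  sum1to (d ℕ.* b) (λ k → when (d ∣? k) (f k)) ≡ sum1to b (λ a → f (d ℕ.* a))
  sum-multiples d@(suc e) zero    f = cong (λ n → sum1to n (λ k → when (d ∣? k) (f k))) (ℕ.*-zeroʳ d)
  sum-multiples d@(suc e) (suc b) f = begin
      sum1to (d ℕ.* suc b) g
    ≡⟨ cong (λ n → sum1to n g) d[1+b]≡db+d ⟩
      sum1to (d ℕ.* b ℕ.+ d) g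
    ≡⟨ sum-split (d ℕ.* b) d g ⟩
      sum1to (d ℕ.* b) g + (sum1to e (λ j → g (d ℕ.* b ℕ.+ j)) + g (d ℕ.* b ℕ.+ d))
    ≡⟨ cong₂ (λ x y → x + (y + g (d ℕ.* b ℕ.+ d)))
             (sum-multiples d b f) (trans (sum-cong e non-multiples) (sum-zero e)) ⟩
      sum1to b (λ a → f (d ℕ.* a)) + (0ℚ + g (d ℕ.* b ℕ.+ d))
    ≡⟨ cong (sum1to b (λ a → f (d ℕ.* a)) +_) (trans (+-identityˡ _) last-multiple) ⟩
      sum1to b (λ a → f (d ℕ.* a)) + f (d ℕ.* suc b)
    ∎
    where
    open ≡-Reasoning
    g : ℕ → ℚ
    g k = when (d ∣? k) (f k)
    d[1+b]≡db+d : d ℕ.* suc b ≡ d ℕ.* b ℕ.+ d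
    d[1+b]≡db+d = trans (ℕ.*-suc d b) (ℕ.+-comm d (d ℕ.* b))
    non-multiples : ∀ j → 1 ℕ.≤ j → j ℕ.≤ e → g (d ℕ.* b ℕ.+ j) ≡ 0ℚ
    non-multiples j 1≤j j≤e = when-no (d ∣? d ℕ.* b ℕ.+ j)
      (λ d∣db+j → ℕ.<⇒≱ (s≤s j≤e) (∣⇒≤ {{ℕ.≢-nonZero (ℕ.m<n⇒n≢0 1≤j)}} (∣m+n∣m⇒∣n d∣db+j (m∣m*n b))))
    last-multiple : g (d ℕ.* b ℕ.+ d) ≡ f (d ℕ.* suc b)
    last-multiple = trans (when-yes (d ∣? d ℕ.* b ℕ.+ d) (∣m∣n⇒∣m+n (m∣m*n b) ∣-refl)) (cong f (sym d[1+b]≡db+d))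

  cofactorSum : ℕ → ℕ → ℚ
  cofactorSum n b = sum1to n (λ k → when (b ℕ.* gcd k n ℕ.≟ n) (gcdOverLcm k n))

  gcdOverLcm-as-sum : ∀ n .{{_ : NonZero n}} k →
    gcdOverLcm k n ≡ sum1to n (λ b → when (b ℕ.* gcd k n ℕ.≟ n) (gcdOverLcm k n))
  gcdOverLcm-as-sum n@(suc _) k with gcd[m,n]∣n k n
  ... | divides (suc q) n≡[1+q]g = sym (begin
      sum1to n (λ b → when (b ℕ.* g ℕ.≟ n) x)
    ≡⟨ sum-cong n (λ b _ _ → when-cong (b ℕ.* g ℕ.≟ n) (b ℕ.≟ suc q)
         (λ bg≡n → ℕ.*-cancelʳ-≡ b (suc q) g {{g≢0}} (trans bg≡n n≡[1+q]g))
         (λ b≡1+q → trans (cong (ℕ._* g) b≡1+q) (sym n≡[1+q]g))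
         (λ _ → refl)) ⟩
      sum1to n (λ b → when (b ℕ.≟ suc q) x)
    ≡⟨ sum-when-≡ n (suc q) x (s≤s z≤n) (∣⇒≤ (divides g (trans n≡[1+q]g (ℕ.*-comm (suc q) g)))) ⟩
      x
    ∎)
    where
    open ≡-Reasoning
    g = gcd k n
    x = gcdOverLcm k n
    g≢0 : NonZero g
    g≢0 = ℕ.≢-nonZero (gcd[m,n]≢0 k n (inj₂ λ ()))

  cofactorSum≡ : ∀ n b .{{_ : NonZero n}} .{{_ : NonZero b}} →
                 cofactorSum n b ≡ when (b ∣? n) (coprimeSum b)
  cofactorSum≡ n@(suc _) b@(suc _) with b ∣? n
  ... | no b∤n = trans (sum-cong n (λ k _ _ → when-no (b ℕ.* gcd k n ℕ.≟ n)
                  (λ bg≡n → b∤n (divides (gcd k n) (trans (sym bg≡n) (ℕ.*-comm b (gcd k n)))))))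
                (sum-zero n)
  ... | yes (divides d@(suc _) n≡db) = begin
      cofactorSum n b
    ≡⟨ sum-cong n (λ k _ _ → multiples-only k) ⟩
      sum1to n (λ k → when (d ∣? k) (term k))
    ≡⟨ cong (λ m → sum1to m (λ k → when (d ∣? k) (term k))) n≡db ⟩
      sum1to (d ℕ.* b) (λ k → when (d ∣? k) (term k))
    ≡⟨ sum-multiples d b term ⟩
      sum1to b (λ a → term (d ℕ.* a))
    ≡⟨ sum-cong b (λ a _ _ → subst (λ m → when (gcd (d ℕ.* a) m ℕ.≟ d) (gcdOverLcm (d ℕ.* a) m)
                                           ≡ [ a ⊥ b ] (recip a * recip b))
                                   (sym n≡db) (gcdOverLcm-scale d a b)) ⟩
      coprimeSum b
    ∎
    where
    open ≡-Reasoning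
    term : ℕ → ℚ
    term k = when (gcd k n ℕ.≟ d) (gcdOverLcm k n)
    bg≡n⇒g≡d : ∀ k → b ℕ.* gcd k n ≡ n → gcd k n ≡ d
    bg≡n⇒g≡d k bg≡n = ℕ.*-cancelʳ-≡ (gcd k n) d b (trans (ℕ.*-comm (gcd k n) b) (trans bg≡n n≡db))
    multiples-only : ∀ k → when (b ℕ.* gcd k n ℕ.≟ n) (gcdOverLcm k n) ≡ when (d ∣? k) (term k)
    multiples-only k with d ∣? k
    ... | yes _  = when-cong (b ℕ.* gcd k n ℕ.≟ n) (gcd k n ℕ.≟ d) (bg≡n⇒g≡d k)
                     (λ g≡d → trans (cong (b ℕ.*_) g≡d) (trans (ℕ.*-comm b d) (sym n≡db))) (λ _ → refl)
    ... | no d∤k = when-no (b ℕ.* gcd k n ℕ.≟ n)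
                     (λ bg≡n → d∤k (subst (_∣ k) (bg≡n⇒g≡d k bg≡n) (gcd[m,n]∣m k n)))

  F≡divisorSum : ∀ n → F n ≡ sum1to n (λ b → when (b ∣? n) (coprimeSum b))
  F≡divisorSum zero        = refl
  F≡divisorSum n@(suc _) = begin
      F n
    ≡⟨ sum-cong n (λ k _ _ → gcdOverLcm-as-sum n k) ⟩
      sum1to n (λ k → sum1to n (λ b → when (b ℕ.* gcd k n ℕ.≟ n) (gcdOverLcm k n)))
    ≡⟨ sum-comm n n (λ k b → when (b ℕ.* gcd k n ℕ.≟ n) (gcdOverLcm k n)) ⟩
      sum1to n (cofactorSum n)
    ≡⟨ sum-cong n (λ { b@(suc _) _ _ → cofactorSum≡ n b }) ⟩
      sum1to n (λ b → when (b ∣? n) (coprimeSum b))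
    ∎
    where open ≡-Reasoning

  multiples : ℕ → ℕ → ℕ
  multiples zero    b = 0
  multiples (suc N) b with b ∣? suc N
  ... | yes _ = suc (multiples N b)
  ... | no _  = multiples N b

  multiples-suc : ∀ N b x → ι (multiples (suc N) b) * x ≡ ι (multiples N b) * x + when (b ∣? suc N) x
  multiples-suc N b x with b ∣? suc N
  ... | yes _ = trans (cong (_* x) (trans (cong ι (ℕ.+-comm 1 (multiples N b))) (ι-+ (multiples N b) 1)))
                (trans (*-distribʳ-+ x (ι (multiples N b)) 1ℚ) (cong (ι (multiples N b) * x +_) (*-identityˡ x)))
  ... | no _  = sym (+-identityʳ _)

  multiples-< : ∀ N b → N ℕ.< b → multiples N b ≡ 0
  multiples-< zero    b _   = refl
  multiples-< (suc N) b N<b with b ∣? suc N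
  ... | yes b∣1+N = contradiction (∣⇒≤ b∣1+N) (ℕ.<⇒≱ N<b)
  ... | no _      = multiples-< N b (ℕ.<-trans (ℕ.n<1+n N) N<b)

  multiples-floor : ∀ N b .{{_ : NonZero b}} →
                    multiples N b ℕ.* b ℕ.≤ N × N ℕ.< suc (multiples N b) ℕ.* b
  multiples-floor zero    b@(suc _) = z≤n , s≤s z≤n
  multiples-floor (suc N) b@(suc _) with b ∣? suc N | multiples-floor N b
  ... | no b∤1+N | qb≤N , N<[1+q]b =
        ℕ.m≤n⇒m≤1+n qb≤N , ℕ.≤∧≢⇒< N<[1+q]b (λ 1+N≡[1+q]b → b∤1+N (divides (suc (multiples N b)) 1+N≡[1+q]b))
  ... | yes (divides q 1+N≡qb) | qᵢb≤N , N<[1+qᵢ]b =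
        ℕ.≤-reflexive [1+qᵢ]b≡1+N , subst (ℕ._< b ℕ.+ suc qᵢ ℕ.* b) [1+qᵢ]b≡1+N (ℕ.m<n+m _ (s≤s z≤n))
    where
    qᵢ = multiples N b
    q≤1+qᵢ : q ℕ.≤ suc qᵢ
    q≤1+qᵢ = ℕ.*-cancelʳ-≤ q (suc qᵢ) b (subst (ℕ._≤ suc qᵢ ℕ.* b) 1+N≡qb N<[1+qᵢ]b)
    qᵢ<q : qᵢ ℕ.< q
    qᵢ<q = ℕ.*-cancelʳ-< b qᵢ q (ℕ.≤-<-trans qᵢb≤N (subst (N ℕ.<_) 1+N≡qb (ℕ.n<1+n N)))
    [1+qᵢ]b≡1+N : suc qᵢ ℕ.* b ≡ suc N
    [1+qᵢ]b≡1+N = trans (cong (ℕ._* b) (ℕ.≤-antisym qᵢ<q q≤1+qᵢ)) (sym 1+N≡qb)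

  sumF≡ : ∀ N → sumF N ≡ sum1to N (λ b → ι (multiples N b) * coprimeSum b)
  sumF≡ zero    = refl
  sumF≡ (suc N) = sym (begin
      sum1to (suc N) (λ b → ι (multiples (suc N) b) * coprimeSum b)
    ≡⟨ sum-cong (suc N) (λ b _ _ → multiples-suc N b (coprimeSum b)) ⟩
      sum1to (suc N) (λ b → ι (multiples N b) * coprimeSum b + when (b ∣? suc N) (coprimeSum b))
    ≡⟨ sum-+ (suc N) _ _ ⟩
      (Σ[N] + ι (multiples N (suc N)) * coprimeSum (suc N))
        + sum1to (suc N) (λ b → when (b ∣? suc N) (coprimeSum b))
    ≡⟨ cong₂ _+_ (cong (Σ[N] +_) no-multiples-beyond-N) (sym (F≡divisorSum (suc N))) ⟩
      (Σ[N] + 0ℚ) + F (suc N)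
    ≡⟨ cong (_+ F (suc N)) (trans (+-identityʳ Σ[N]) (sym (sumF≡ N))) ⟩
      sumF N + F (suc N)
    ∎)
    where
    open ≡-Reasoning
    Σ[N] = sum1to N (λ b → ι (multiples N b) * coprimeSum b)
    no-multiples-beyond-N : ι (multiples N (suc N)) * coprimeSum (suc N) ≡ 0ℚ
    no-multiples-beyond-N = trans (cong (λ m → ι m * coprimeSum (suc N)) (multiples-< N (suc N) (ℕ.n<1+n N)))
                                  (*-zeroˡ (coprimeSum (suc N)))

  coprimeSum₂ : ℕ → ℚ
  coprimeSum₂ b = sum1to b (λ a → [ a ⊥ b ] (recip a * recip b * recip b))

  totalCoprimeSum : ℕ → ℚ
  totalCoprimeSum N = sum1to N coprimeSum

  totalCoprimeSum₂ : ℕ → ℚ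
  totalCoprimeSum₂ N = sum1to N coprimeSum₂

  [⊥]-nonNeg : ∀ a b {x} → 0ℚ ≤ x → 0ℚ ≤ [ a ⊥ b ] x
  [⊥]-nonNeg a b = when-nonNeg (gcd a b ℕ.≟ 1)

  coprimeSum₂-nonNeg : ∀ b → 0ℚ ≤ coprimeSum₂ b
  coprimeSum₂-nonNeg b = sum-nonNeg b (λ a _ _ → [⊥]-nonNeg a b
    (*-nonNeg (*-nonNeg (recip-nonNeg a) (recip-nonNeg b)) (recip-nonNeg b)))

  coprimeSum≡ι*coprimeSum₂ : ∀ b → coprimeSum b ≡ ι b * coprimeSum₂ b
  coprimeSum≡ι*coprimeSum₂ zero      = sym (*-zeroʳ (ι 0))
  coprimeSum≡ι*coprimeSum₂ b@(suc _) = sym (trans (sym (sum-*ˡ b (ι b) _))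
    (sum-cong b (λ a _ _ → trans (*-when (gcd a b ℕ.≟ 1) (ι b) _) (cong (when (gcd a b ℕ.≟ 1)) (cancel a)))))
    where
    cancel : ∀ a → ι b * (recip a * recip b * recip b) ≡ recip a * recip b
    cancel a = trans (solve 3 (λ n x y → n :* (x :* y :* y) := (n :* y) :* (x :* y)) refl (ι b) (recip a) (recip b))
                     (trans (cong (_* (recip a * recip b)) (ι*recip b)) (*-identityˡ _))
      where open ℚ-Solver

  -- Each term of sumF≡ is ⌊N/b⌋ b · coprimeSum₂ b, and N − b < ⌊N/b⌋ b ≤ N (multiples-floor).
  sumF≤ : ∀ N → sumF N ≤ ι N * totalCoprimeSum₂ N
  sumF≤ N = subst₂ _≤_ (sym (sumF≡ N)) (sum-*ˡ N (ι N) coprimeSum₂) (sum-mono N term≤)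
    where
    term≤ : ∀ b → 1 ℕ.≤ b → b ℕ.≤ N → ι (multiples N b) * coprimeSum b ≤ ι N * coprimeSum₂ b
    term≤ b@(suc _) _ _ = begin
        ι (multiples N b) * coprimeSum b
      ≡⟨ cong (ι (multiples N b) *_) (coprimeSum≡ι*coprimeSum₂ b) ⟩
        ι (multiples N b) * (ι b * coprimeSum₂ b)
      ≡⟨ trans (sym (*-assoc (ι (multiples N b)) (ι b) (coprimeSum₂ b)))
               (cong (_* coprimeSum₂ b) (sym (ι-* (multiples N b) b))) ⟩
        ι (multiples N b ℕ.* b) * coprimeSum₂ b
      ≤⟨ *-monoʳ-≤-nonNeg (coprimeSum₂ b) {{nonNegative (coprimeSum₂-nonNeg b)}}
           (ι-mono-≤ (proj₁ (multiples-floor N b))) ⟩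
        ι N * coprimeSum₂ b
      ∎
      where open ≤-Reasoning

  ι*totalCoprimeSum₂≤ : ∀ N → ι N * totalCoprimeSum₂ N ≤ sumF N + totalCoprimeSum N
  ι*totalCoprimeSum₂≤ N = subst₂ _≤_ (sum-*ˡ N (ι N) coprimeSum₂)
    (trans (sum-+ N _ _) (cong (_+ totalCoprimeSum N) (sym (sumF≡ N)))) (sum-mono N term≤)
    where
    term≤ : ∀ b → 1 ℕ.≤ b → b ℕ.≤ N → ι N * coprimeSum₂ b ≤ ι (multiples N b) * coprimeSum b + coprimeSum b
    term≤ b@(suc _) _ _ = begin
        ι N * coprimeSum₂ b
      ≤⟨ *-monoʳ-≤-nonNeg (coprimeSum₂ b) {{nonNegative (coprimeSum₂-nonNeg b)}}
           (ι-mono-≤ (ℕ.≤-trans (ℕ.<⇒≤ (proj₂ (multiples-floor N b))) (ℕ.≤-reflexive (ℕ.+-comm b (q ℕ.* b))))) ⟩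
        ι (q ℕ.* b ℕ.+ b) * coprimeSum₂ b
      ≡⟨ cong (_* coprimeSum₂ b) (trans (ι-+ (q ℕ.* b) b) (cong (_+ ι b) (ι-* q b))) ⟩
        (ι q * ι b + ι b) * coprimeSum₂ b
      ≡⟨ *-distribʳ-+ (coprimeSum₂ b) (ι q * ι b) (ι b) ⟩
        ι q * ι b * coprimeSum₂ b + ι b * coprimeSum₂ b
      ≡⟨ cong₂ _+_ (trans (*-assoc (ι q) (ι b) _) (cong (ι q *_) (sym (coprimeSum≡ι*coprimeSum₂ b))))
                   (sym (coprimeSum≡ι*coprimeSum₂ b)) ⟩
        ι q * coprimeSum b + coprimeSum b
      ∎
      where
      open ≤-Reasoning
      q = multiples N b

  [⊥]-cong : ∀ a b c d → gcd a b ≡ gcd c d → ∀ x → [ a ⊥ b ] x ≡ [ c ⊥ d ] x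
  [⊥]-cong a b c d eq x = when-cong (gcd a b ℕ.≟ 1) (gcd c d ℕ.≟ 1) (trans (sym eq)) (trans eq) (λ _ → refl)

  [⊥]-+ : ∀ a b x y → [ a ⊥ b ] x + [ a ⊥ b ] y ≡ [ a ⊥ b ] (x + y)
  [⊥]-+ a b x y with gcd a b ℕ.≟ 1
  ... | yes _ = refl
  ... | no _  = +-identityˡ 0ℚ

  -- For coprime a < b, subtreeMass a b is the sum of 1/(a′b′²) over the pairs a′ < b′ in the subtree
  -- rooted at (a, b) of the tree generated by (a, b) ↦ (a, a + b), (b, a + b); subtreeMass-split is
  -- the recursion expressing this.
  subtreeMass : ℕ → ℕ → ℚ
  subtreeMass a b = (recip a + (recip b + recip b)) * recip a * recip b

  subtreeMass-nonNeg : ∀ a b → 0ℚ ≤ subtreeMass a b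
  subtreeMass-nonNeg a b = *-nonNeg (*-nonNeg
    (+-nonNeg (recip-nonNeg a) (+-nonNeg (recip-nonNeg b) (recip-nonNeg b))) (recip-nonNeg a)) (recip-nonNeg b)

  recip-mediant : ∀ a b .{{_ : NonZero a}} .{{_ : NonZero b}} →
                  recip a * recip b ≡ recip (b ℕ.+ a) * (recip a + recip b)
  recip-mediant a@(suc _) b@(suc _) = begin
      x * y
    ≡⟨ sym (*-identityʳ (x * y)) ⟩
      x * y * 1ℚ
    ≡⟨ cong (x * y *_) (sym (ι*recip (b ℕ.+ a))) ⟩
      x * y * (ι (b ℕ.+ a) * z)
    ≡⟨ cong (λ t → x * y * (t * z)) (ι-+ b a) ⟩
      x * y * ((ι b + ι a) * z)
    ≡⟨ solve 5 (λ x y z ib ia → x :* y :* ((ib :+ ia) :* z) := z :* (x :* (ib :* y) :+ y :* (ia :* x)))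
               refl x y z (ι b) (ι a) ⟩
      z * (x * (ι b * y) + y * (ι a * x))
    ≡⟨ cong₂ (λ u v → z * (x * u + y * v)) (ι*recip b) (ι*recip a) ⟩
      z * (x * 1ℚ + y * 1ℚ)
    ≡⟨ cong (z *_) (cong₂ _+_ (*-identityʳ x) (*-identityʳ y)) ⟩
      z * (x + y)
    ∎
    where
    open ≡-Reasoning
    open ℚ-Solver
    x = recip a
    y = recip b
    z = recip (b ℕ.+ a)

  subtreeMass-split : ∀ a b .{{_ : NonZero a}} .{{_ : NonZero b}} →
    subtreeMass a (b ℕ.+ a) + subtreeMass b (b ℕ.+ a) + recip a * recip b * recip b ≡ subtreeMass a b
  -- Adding xy(x + y + 2z) to both sides leaves a polynomial identity modulo xy = z(x + y).
  subtreeMass-split a b = ∙-cancelʳ (x * y * (x + y + z + z)) _ _ (begin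
      ((x + (z + z)) * x * z + (y + (z + z)) * y * z + x * y * y) + x * y * (x + y + z + z)
    ≡⟨ solve 3 (λ x y z → ((x :+ (z :+ z)) :* x :* z :+ (y :+ (z :+ z)) :* y :* z :+ x :* y :* y)
                          :+ x :* y :* (x :+ y :+ z :+ z)
                        := (x :+ (y :+ y)) :* x :* y :+ z :* (x :+ y) :* (x :+ y :+ z :+ z)) refl x y z ⟩
      (x + (y + y)) * x * y + z * (x + y) * (x + y + z + z)
    ≡⟨ cong (λ t → (x + (y + y)) * x * y + t * (x + y + z + z)) (sym (recip-mediant a b)) ⟩
      (x + (y + y)) * x * y + x * y * (x + y + z + z)
    ∎)
    where
    open ≡-Reasoning
    open ℚ-Solver
    x = recip a
    y = recip b
    z = recip (b ℕ.+ a)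

  treeMass : ℕ → ℕ → ℚ
  treeMass a b = [ a ⊥ b ] subtreeMass a b

  treeMass-nonNeg : ∀ a b → 0ℚ ≤ treeMass a b
  treeMass-nonNeg a b = [⊥]-nonNeg a b (subtreeMass-nonNeg a b)

  treeMass-split : ∀ a b .{{_ : NonZero a}} .{{_ : NonZero b}} →
    treeMass a (b ℕ.+ a) + treeMass b (b ℕ.+ a) + [ a ⊥ b ] (recip a * recip b * recip b) ≡ treeMass a b
  treeMass-split a b = begin
      [ a ⊥ b ℕ.+ a ] subtreeMass a (b ℕ.+ a) + [ b ⊥ b ℕ.+ a ] subtreeMass b (b ℕ.+ a) + [ a ⊥ b ] t
    ≡⟨ cong₂ (λ u v → u + v + [ a ⊥ b ] t)
             ([⊥]-cong a (b ℕ.+ a) a b (gcd[m,n+m]≡gcd[m,n] a b) _)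
             ([⊥]-cong b (b ℕ.+ a) a b (gcd[n,n+m]≡gcd[m,n] a b) _) ⟩
      [ a ⊥ b ] subtreeMass a (b ℕ.+ a) + [ a ⊥ b ] subtreeMass b (b ℕ.+ a) + [ a ⊥ b ] t
    ≡⟨ trans (cong (_+ [ a ⊥ b ] t) ([⊥]-+ a b _ _)) ([⊥]-+ a b _ _) ⟩
      [ a ⊥ b ] (subtreeMass a (b ℕ.+ a) + subtreeMass b (b ℕ.+ a) + t)
    ≡⟨ cong ([ a ⊥ b ]_) (subtreeMass-split a b) ⟩
      [ a ⊥ b ] subtreeMass a b
    ∎
    where
    open ≡-Reasoning
    t = recip a * recip b * recip b

  sum-shift : ∀ n (f : ℕ → ℚ) → sum1to n f + f (suc n) ≡ f 1 + sum1to n (λ c → f (suc c))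
  sum-shift n f = trans (sum-split 1 n f) (cong (_+ sum1to n (λ c → f (suc c))) (+-identityˡ (f 1)))

  -- The pairs (a, N + c) with 1 ≤ c ≤ a ≤ N are the children beyond N of the pairs with both entries
  -- at most N; their subtrees hold exactly the pairs missing from totalCoprimeSum₂ N.
  tailMass : ℕ → ℚ
  tailMass N = sum1to N (λ a → sum1to a (λ c → treeMass a (N ℕ.+ c)))

  tailMass-nonNeg : ∀ N → 0ℚ ≤ tailMass N
  tailMass-nonNeg N = sum-nonNeg N (λ a _ _ → sum-nonNeg a (λ c _ _ → treeMass-nonNeg a (N ℕ.+ c)))

  tailMass-row : ∀ N a .{{_ : NonZero a}} →
    sum1to a (λ c → treeMass a (suc N ℕ.+ c))
      + (treeMass (suc N) (suc N ℕ.+ a) + [ a ⊥ suc N ] (recip a * recip (suc N) * recip (suc N)))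
    ≡ sum1to a (λ c → treeMass a (N ℕ.+ c))
  tailMass-row N a = ∙-cancelʳ X _ _ (begin
      (U + (Y + Z)) + X
    ≡⟨ solve 4 (λ u x y z → (u :+ (y :+ z)) :+ x := (x :+ y :+ z) :+ u) refl U X Y Z ⟩
      (X + Y + Z) + U
    ≡⟨ cong₂ _+_ (trans (treeMass-split a M) (cong (treeMass a) (ℕ.+-comm 1 N)))
                 (sum-cong a (λ c _ _ → cong (treeMass a) (sym (ℕ.+-suc N c)))) ⟩
      f 1 + sum1to a (λ c → f (suc c))
    ≡⟨ sym (sum-shift a f) ⟩
      sum1to a f + f (suc a)
    ≡⟨ cong (sum1to a f +_) (cong (treeMass a) (ℕ.+-suc N a)) ⟩
      sum1to a f + X
    ∎)
    where
    open ≡-Reasoning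
    open ℚ-Solver
    M = suc N
    f : ℕ → ℚ
    f c = treeMass a (N ℕ.+ c)
    U = sum1to a (λ c → treeMass a (M ℕ.+ c))
    X = treeMass a (M ℕ.+ a)
    Y = treeMass M (M ℕ.+ a)
    Z = [ a ⊥ M ] (recip a * recip M * recip M)

  [n⊥n]≡0 : ∀ n x → n ≢ 1 → [ n ⊥ n ] x ≡ 0ℚ
  [n⊥n]≡0 n x n≢1 = when-no (gcd n n ℕ.≟ 1) (n≢1 ∘ trans (sym (gcd[n,n]≡n n)))

  totalCoprimeSum₂+tailMass-suc : ∀ N .{{_ : NonZero N}} →
    totalCoprimeSum₂ (suc N) + tailMass (suc N) ≡ totalCoprimeSum₂ N + tailMass N
  totalCoprimeSum₂+tailMass-suc N@(suc _) = begin
      (totalCoprimeSum₂ N + (newTerms + [ M ⊥ M ] t M)) + (innerRows + (lastRow + treeMass M (M ℕ.+ M)))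
    ≡⟨ cong₂ (λ u v → (totalCoprimeSum₂ N + (newTerms + u)) + (innerRows + (lastRow + v)))
             ([n⊥n]≡0 M (t M) M≢1)
             (trans ([⊥]-cong M (M ℕ.+ M) M M (gcd[n,n+m]≡gcd[m,n] M M) _) ([n⊥n]≡0 M _ M≢1)) ⟩
      (totalCoprimeSum₂ N + (newTerms + 0ℚ)) + (innerRows + (lastRow + 0ℚ))
    ≡⟨ solve 4 (λ p s i k → (p :+ (s :+ con 0ℚ)) :+ (i :+ (k :+ con 0ℚ)) := p :+ (i :+ (k :+ s)))
               refl (totalCoprimeSum₂ N) newTerms innerRows lastRow ⟩
      totalCoprimeSum₂ N + (innerRows + (lastRow + newTerms))
    ≡⟨ cong (totalCoprimeSum₂ N +_) (trans (cong (innerRows +_) (sym (sum-+ N _ _))) (sym (sum-+ N _ _))) ⟩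
      totalCoprimeSum₂ N + sum1to N (λ a → sum1to a (λ c → treeMass a (M ℕ.+ c))
                                            + (treeMass M (M ℕ.+ a) + [ a ⊥ M ] t a))
    ≡⟨ cong (totalCoprimeSum₂ N +_) (sum-cong N (λ { a@(suc _) _ _ → tailMass-row N a })) ⟩
      totalCoprimeSum₂ N + tailMass N
    ∎
    where
    open ≡-Reasoning
    open ℚ-Solver
    M = suc N
    t : ℕ → ℚ
    t a = recip a * recip M * recip M
    newTerms = sum1to N (λ a → [ a ⊥ M ] t a)
    innerRows = sum1to N (λ a → sum1to a (λ c → treeMass a (M ℕ.+ c)))
    lastRow = sum1to N (λ c → treeMass M (M ℕ.+ c))
    M≢1 : M ≢ 1
    M≢1 ()

  totalCoprimeSum₂+tailMass≡2 : ∀ N .{{_ : NonZero N}} → totalCoprimeSum₂ N + tailMass N ≡ ι 2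
  totalCoprimeSum₂+tailMass≡2 (suc zero)      = refl
  totalCoprimeSum₂+tailMass≡2 (suc N@(suc _)) =
    trans (totalCoprimeSum₂+tailMass-suc N) (totalCoprimeSum₂+tailMass≡2 N)

  harmonic : ℕ → ℚ
  harmonic N = sum1to N recip

  harmonic-nonNeg : ∀ N → 0ℚ ≤ harmonic N
  harmonic-nonNeg N = sum-nonNeg N (λ j _ _ → recip-nonNeg j)

  ι*recip≤1 : ∀ {m n} .{{_ : NonZero n}} → m ℕ.≤ n → ι m * recip n ≤ 1ℚ
  ι*recip≤1 {m} {n} m≤n = subst (ι m * recip n ≤_) (ι*recip n)
    (*-monoʳ-≤-nonNeg (recip n) {{nonNegative (recip-nonNeg n)}} (ι-mono-≤ m≤n))

  ι*treeMass≤ : ∀ N a c .{{_ : NonZero a}} → a ℕ.≤ N → ι N * treeMass a (N ℕ.+ c) ≤ ι 3 * (recip a * recip a)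
  ι*treeMass≤ N a c a≤N = begin
      ι N * treeMass a b
    ≤⟨ *-monoˡ-≤-nonNeg (ι N) {{nonNegative (ι-nonNeg N)}} (when-≤ (gcd a b ℕ.≟ 1) (subtreeMass-nonNeg a b)) ⟩
      ι N * ((x + (y + y)) * x * y)
    ≡⟨ solve 3 (λ n x y → n :* ((x :+ (y :+ y)) :* x :* y) := ((x :+ (y :+ y)) :* x) :* (n :* y)) refl (ι N) x y ⟩
      (x + (y + y)) * x * (ι N * y)
    ≤⟨ *-monoˡ-≤-nonNeg ((x + (y + y)) * x) {{nonNegative 0≤[x+2y]x}} (ι*recip≤1 {{b≢0}} (ℕ.m≤m+n N c)) ⟩
      (x + (y + y)) * x * 1ℚ
    ≤⟨ *-monoʳ-≤-nonNeg 1ℚ {{nonNegative (ι-nonNeg 1)}}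
         (*-monoʳ-≤-nonNeg x {{nonNegative (recip-nonNeg a)}} (+-monoʳ-≤ x (+-mono-≤ y≤x y≤x))) ⟩
      (x + (x + x)) * x * 1ℚ
    ≡⟨ solve 1 (λ x → (x :+ (x :+ x)) :* x :* con 1ℚ := con (ι 3) :* (x :* x)) refl x ⟩
      ι 3 * (x * x)
    ∎
    where
    open ≤-Reasoning
    open ℚ-Solver
    b = N ℕ.+ c
    x = recip a
    y = recip b
    b≢0 : NonZero b
    b≢0 = ℕ.>-nonZero (ℕ.<-≤-trans (ℕ.>-nonZero⁻¹ a) (ℕ.≤-trans a≤N (ℕ.m≤m+n N c)))
    y≤x : y ≤ x
    y≤x = recip-antitone (ℕ.≤-trans a≤N (ℕ.m≤m+n N c))
    0≤[x+2y]x : 0ℚ ≤ (x + (y + y)) * x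
    0≤[x+2y]x = *-nonNeg (+-nonNeg (recip-nonNeg a) (+-nonNeg (recip-nonNeg b) (recip-nonNeg b))) (recip-nonNeg a)

  ι*tailMass≤ : ∀ N → ι N * tailMass N ≤ ι 3 * harmonic N
  ι*tailMass≤ N = begin
      ι N * tailMass N
    ≡⟨ sym (trans (sum-cong N (λ a _ _ → sum-*ˡ a (ι N) _)) (sum-*ˡ N (ι N) _)) ⟩
      sum1to N (λ a → sum1to a (λ c → ι N * treeMass a (N ℕ.+ c)))
    ≤⟨ sum-mono N (λ { a@(suc _) _ a≤N → sum-mono a (λ c _ _ → ι*treeMass≤ N a c a≤N) }) ⟩
      sum1to N (λ a → sum1to a (λ _ → ι 3 * (recip a * recip a)))
    ≡⟨ sum-cong N (λ { a@(suc _) _ _ → trans (sum-const a _) (row a) }) ⟩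
      sum1to N (λ a → ι 3 * recip a)
    ≡⟨ sum-*ˡ N (ι 3) recip ⟩
      ι 3 * harmonic N
    ∎
    where
    open ≤-Reasoning
    row : ∀ a .{{_ : NonZero a}} → ι a * (ι 3 * (recip a * recip a)) ≡ ι 3 * recip a
    row a = trans (solve 3 (λ i t x → i :* (t :* (x :* x)) := t :* x :* (i :* x)) refl (ι a) (ι 3) (recip a))
                  (trans (cong (ι 3 * recip a *_) (ι*recip a)) (*-identityʳ _))
      where open ℚ-Solver

  totalCoprimeSum≤ : ∀ N → totalCoprimeSum N ≤ harmonic N * harmonic N
  totalCoprimeSum≤ N = begin
      totalCoprimeSum N
    ≤⟨ sum-mono N coprimeSum≤ ⟩
      sum1to N (λ b → harmonic N * recip b)
    ≡⟨ sum-*ˡ N (harmonic N) recip ⟩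
      harmonic N * harmonic N
    ∎
    where
    open ≤-Reasoning
    coprimeSum≤ : ∀ b → 1 ℕ.≤ b → b ℕ.≤ N → coprimeSum b ≤ harmonic N * recip b
    coprimeSum≤ b _ b≤N = begin
        coprimeSum b
      ≤⟨ sum-mono b (λ a _ _ → when-≤ (gcd a b ℕ.≟ 1) (*-nonNeg (recip-nonNeg a) (recip-nonNeg b))) ⟩
        sum1to b (λ a → recip a * recip b)
      ≤⟨ sum-extend b≤N (λ a _ → *-nonNeg (recip-nonNeg a) (recip-nonNeg b)) ⟩
        sum1to N (λ a → recip a * recip b)
      ≡⟨ trans (sum-cong N (λ a _ _ → *-comm (recip a) (recip b)))
               (trans (sum-*ˡ N (recip b) recip) (*-comm (recip b) (harmonic N))) ⟩
        harmonic N * recip b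
      ∎

  harmonic-tail≤1 : ∀ m t → t ℕ.≤ suc m → sum1to t (λ j → recip (m ℕ.+ j)) ≤ 1ℚ
  harmonic-tail≤1 m t t≤1+m = begin
      sum1to t (λ j → recip (m ℕ.+ j))
    ≤⟨ sum-mono t (λ j 1≤j _ → recip-antitone (subst (ℕ._≤ m ℕ.+ j) (ℕ.+-comm m 1) (ℕ.+-monoʳ-≤ m 1≤j))) ⟩
      sum1to t (λ _ → recip (suc m))
    ≡⟨ sum-const t (recip (suc m)) ⟩
      ι t * recip (suc m)
    ≤⟨ ι*recip≤1 t≤1+m ⟩
      1ℚ
    ∎
    where open ≤-Reasoning

  ⌈n/2⌉≤1+⌊n/2⌋ : ∀ n → ℕ.⌈ n /2⌉ ℕ.≤ suc ℕ.⌊ n /2⌋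
  ⌈n/2⌉≤1+⌊n/2⌋ zero          = z≤n
  ⌈n/2⌉≤1+⌊n/2⌋ (suc zero)    = ℕ.≤-refl
  ⌈n/2⌉≤1+⌊n/2⌋ (suc (suc n)) = s≤s (⌈n/2⌉≤1+⌊n/2⌋ n)

  harmonic≤log₂ : ∀ N → harmonic N ≤ ι (⌊log₂ N ⌋ ℕ.+ 1)
  harmonic≤log₂ = <-rec (λ N → harmonic N ≤ ι (⌊log₂ N ⌋ ℕ.+ 1)) step
    where
    step : ∀ N → (∀ {m} → m ℕ.< N → harmonic m ≤ ι (⌊log₂ m ⌋ ℕ.+ 1)) → harmonic N ≤ ι (⌊log₂ N ⌋ ℕ.+ 1)
    step zero                 _   = ι-nonNeg 1
    step (suc zero)           _   = ≤-refl
    step N@(suc n@(suc _)) rec = begin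
        harmonic N
      ≡⟨ cong (λ k → sum1to k recip) (sym (ℕ.⌊n/2⌋+⌈n/2⌉≡n N)) ⟩
        sum1to (m ℕ.+ ℕ.⌈ N /2⌉) recip
      ≡⟨ sum-split m ℕ.⌈ N /2⌉ recip ⟩
        harmonic m + sum1to ℕ.⌈ N /2⌉ (λ j → recip (m ℕ.+ j))
      ≤⟨ +-mono-≤ (rec (ℕ.⌊n/2⌋<n n)) (harmonic-tail≤1 m ℕ.⌈ N /2⌉ (⌈n/2⌉≤1+⌊n/2⌋ N)) ⟩
        ι (⌊log₂ m ⌋ ℕ.+ 1) + ι 1
      ≡⟨ sym (ι-+ (⌊log₂ m ⌋ ℕ.+ 1) 1) ⟩
        ι (⌊log₂ m ⌋ ℕ.+ 1 ℕ.+ 1)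
      ≡⟨ cong (λ k → ι (k ℕ.+ 1)) (trans (cong (ℕ._+ 1) (⌊log₂⌊n/2⌋⌋≡⌊log₂n⌋∸1 N)) (ℕ.m∸n+n≡m 1≤⌊log₂N⌋)) ⟩
        ι (⌊log₂ N ⌋ ℕ.+ 1)
      ∎
      where
      open ≤-Reasoning
      m = ℕ.⌊ N /2⌋
      1≤⌊log₂N⌋ : 1 ℕ.≤ ⌊log₂ N ⌋
      1≤⌊log₂N⌋ = ⌊log₂⌋-mono-≤ {2} {N} (s≤s (s≤s z≤n))

  ∣p-q∣≤r : ∀ {p q r} → p ≤ q → q ≤ p + r → ∣ p - q ∣ ≤ r
  ∣p-q∣≤r {p} {q} {r} p≤q q≤p+r = begin
      ∣ p - q ∣
    ≡⟨ trans (sym (∣-p∣≡∣p∣ (p - q))) (cong ∣_∣ (solve 2 (λ p q → :- (p :- q) := q :- p) refl p q)) ⟩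
      ∣ q - p ∣
    ≡⟨ 0≤p⇒∣p∣≡p (subst (_≤ q - p) (+-inverseʳ p) (+-monoˡ-≤ (- p) p≤q)) ⟩
      q - p
    ≤⟨ +-monoˡ-≤ (- p) q≤p+r ⟩
      p + r - p
    ≡⟨ solve 2 (λ p r → p :+ r :- p := r) refl p r ⟩
      r
    ∎
    where
    open ≤-Reasoning
    open ℚ-Solver

  sumF-sandwich : ∀ N .{{_ : NonZero N}} →
    sumF N ≤ ι (2 ℕ.* N) × ι (2 ℕ.* N) ≤ sumF N + (totalCoprimeSum N + ι N * tailMass N)
  sumF-sandwich N = sumF≤2N , 2N≤sumF+error
    where
    ι[2N]≡ : ι (2 ℕ.* N) ≡ ι N * totalCoprimeSum₂ N + ι N * tailMass N
    ι[2N]≡ = trans (trans (ι-* 2 N) (*-comm (ι 2) (ι N)))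
                (trans (cong (ι N *_) (sym (totalCoprimeSum₂+tailMass≡2 N))) (*-distribˡ-+ (ι N) _ _))
    sumF≤2N : sumF N ≤ ι (2 ℕ.* N)
    sumF≤2N = ≤-trans (sumF≤ N) (subst (ι N * totalCoprimeSum₂ N ≤_) (sym ι[2N]≡)
      (subst (_≤ ι N * totalCoprimeSum₂ N + ι N * tailMass N) (+-identityʳ _)
        (+-monoʳ-≤ (ι N * totalCoprimeSum₂ N) (*-nonNeg (ι-nonNeg N) (tailMass-nonNeg N)))))
    2N≤sumF+error : ι (2 ℕ.* N) ≤ sumF N + (totalCoprimeSum N + ι N * tailMass N)
    2N≤sumF+error = subst₂ _≤_ (sym ι[2N]≡) (+-assoc (sumF N) _ _)
      (+-monoˡ-≤ (ι N * tailMass N) (ι*totalCoprimeSum₂≤ N))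

  [L+1]²+3[L+1]≤10L² : ∀ L → 1 ℕ.≤ L → (L ℕ.+ 1) ℕ.* (L ℕ.+ 1) ℕ.+ 3 ℕ.* (L ℕ.+ 1) ℕ.≤ 10 ℕ.* L ℕ.^ 2
  [L+1]²+3[L+1]≤10L² L@(suc l) _ = subst ((L ℕ.+ 1) ℕ.* (L ℕ.+ 1) ℕ.+ 3 ℕ.* (L ℕ.+ 1) ℕ.≤_)
    (solve 1 (λ l → ((con 1 :+ l :+ con 1) :* (con 1 :+ l :+ con 1) :+ con 3 :* (con 1 :+ l :+ con 1))
                      :+ (con 9 :* l :* l :+ con 13 :* l)
                    := con 10 :* ((con 1 :+ l) :* ((con 1 :+ l) :* con 1))) refl l)
    (ℕ.m≤m+n _ (9 ℕ.* l ℕ.* l ℕ.+ 13 ℕ.* l))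
    where open ℕ-Solver

  sumF-error : ∀ N → 2 ℕ.≤ N → ∣ sumF N - ι (2 ℕ.* N) ∣ ≤ ι (10 ℕ.* ⌊log₂ N ⌋ ℕ.^ 2)
  sumF-error N@(suc _) 2≤N = ≤-trans (∣p-q∣≤r (proj₁ (sumF-sandwich N)) (proj₂ (sumF-sandwich N))) (begin
      totalCoprimeSum N + ι N * tailMass N
    ≤⟨ +-mono-≤ (totalCoprimeSum≤ N) (ι*tailMass≤ N) ⟩
      H * H + ι 3 * H
    ≤⟨ +-mono-≤ (*-mono-≤-nonNeg (harmonic-nonNeg N) (harmonic-nonNeg N) (harmonic≤log₂ N) (harmonic≤log₂ N))
                (*-monoˡ-≤-nonNeg (ι 3) {{nonNegative (ι-nonNeg 3)}} (harmonic≤log₂ N)) ⟩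
      ι (L ℕ.+ 1) * ι (L ℕ.+ 1) + ι 3 * ι (L ℕ.+ 1)
    ≡⟨ sym (trans (ι-+ ((L ℕ.+ 1) ℕ.* (L ℕ.+ 1)) (3 ℕ.* (L ℕ.+ 1)))
               (cong₂ _+_ (ι-* (L ℕ.+ 1) (L ℕ.+ 1)) (ι-* 3 (L ℕ.+ 1)))) ⟩
      ι ((L ℕ.+ 1) ℕ.* (L ℕ.+ 1) ℕ.+ 3 ℕ.* (L ℕ.+ 1))
    ≤⟨ ι-mono-≤ ([L+1]²+3[L+1]≤10L² L (⌊log₂⌋-mono-≤ {2} {N} 2≤N)) ⟩
      ι (10 ℕ.* L ℕ.^ 2)
    ∎)
    where
    open ≤-Reasoning
    H = harmonic N
    L = ⌊log₂ N ⌋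

  doubleSum+N≡2sumF : ∀ N → doubleSum N + ι N ≡ sumF N + sumF N
  doubleSum+N≡2sumF zero    = refl
  doubleSum+N≡2sumF (suc N) = begin
      (sum1to N (λ m → sum1to N (λ n → gcdOverLcm m n) + gcdOverLcm m M)
        + (sum1to N (gcdOverLcm M) + gcdOverLcm M M)) + ι M
    ≡⟨ cong₂ (λ u v → (u + (v + gcdOverLcm M M)) + ι M)
             (sum-+ N _ _) (sum-cong N (λ n _ _ → gcdOverLcm-comm M n)) ⟩
      ((doubleSum N + X) + (X + gcdOverLcm M M)) + ι M
    ≡⟨ cong₂ (λ u v → ((doubleSum N + X) + (X + u)) + v) (gcdOverLcm[n,n]≡1 M) (ι-+ 1 N) ⟩
      ((doubleSum N + X) + (X + 1ℚ)) + (1ℚ + ι N)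
    ≡⟨ solve 3 (λ d i x → ((d :+ x) :+ (x :+ con 1ℚ)) :+ (con 1ℚ :+ i)
                         := (d :+ i) :+ (con 1ℚ :+ x :+ x :+ con 1ℚ))
               refl (doubleSum N) (ι N) X ⟩
      (doubleSum N + ι N) + (1ℚ + X + X + 1ℚ)
    ≡⟨ cong (_+ (1ℚ + X + X + 1ℚ)) (doubleSum+N≡2sumF N) ⟩
      (sumF N + sumF N) + (1ℚ + X + X + 1ℚ)
    ≡⟨ cong (λ u → (sumF N + sumF N) + (u + X + X + u)) (sym (gcdOverLcm[n,n]≡1 M)) ⟩
      (sumF N + sumF N) + (D + X + X + D)
    ≡⟨ solve 3 (λ s x d → (s :+ s) :+ (d :+ x :+ x :+ d) := (s :+ (x :+ d)) :+ (s :+ (x :+ d)))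
               refl (sumF N) X D ⟩
      sumF M + sumF M
    ∎
    where
    open ≡-Reasoning
    open ℚ-Solver
    M = suc N
    X = sum1to N (λ k → gcdOverLcm k M)
    D = gcdOverLcm M M

  doubleSum-error : ∀ N → 2 ℕ.≤ N → ∣ doubleSum N - ι (3 ℕ.* N) ∣ ≤ ι (20 ℕ.* ⌊log₂ N ⌋ ℕ.^ 2)
  doubleSum-error N 2≤N = begin
      ∣ doubleSum N - ι (3 ℕ.* N) ∣
    ≡⟨ cong ∣_∣ doubleSum-3N≡2[sumF-2N] ⟩
      ∣ e + e ∣
    ≤⟨ ∣p+q∣≤∣p∣+∣q∣ e e ⟩
      ∣ e ∣ + ∣ e ∣
    ≤⟨ +-mono-≤ (sumF-error N 2≤N) (sumF-error N 2≤N) ⟩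
      ι (10 ℕ.* L²) + ι (10 ℕ.* L²)
    ≡⟨ trans (sym (ι-+ (10 ℕ.* L²) (10 ℕ.* L²))) (cong ι (sym (ℕ.*-distribʳ-+ L² 10 10))) ⟩
      ι (20 ℕ.* L²)
    ∎
    where
    open ≤-Reasoning
    L² = ⌊log₂ N ⌋ ℕ.^ 2
    e = sumF N - ι (2 ℕ.* N)
    doubleSum-3N≡2[sumF-2N] : doubleSum N - ι (3 ℕ.* N) ≡ e + e
    doubleSum-3N≡2[sumF-2N] = begin-equality
        doubleSum N - ι (3 ℕ.* N)
      ≡⟨ cong (λ t → doubleSum N - t) (ι-* 3 N) ⟩
        doubleSum N - ι 3 * ι N
      ≡⟨ solve 2 (λ d n → d :- con (ι 3) :* n := (d :+ n) :- con (ι 4) :* n) refl (doubleSum N) (ι N) ⟩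
        (doubleSum N + ι N) - ι 4 * ι N
      ≡⟨ cong (_- ι 4 * ι N) (doubleSum+N≡2sumF N) ⟩
        (sumF N + sumF N) - ι 4 * ι N
      ≡⟨ solve 2 (λ s n → (s :+ s) :- con (ι 4) :* n := (s :- con (ι 2) :* n) :+ (s :- con (ι 2) :* n))
                 refl (sumF N) (ι N) ⟩
        (sumF N - ι 2 * ι N) + (sumF N - ι 2 * ι N)
      ≡⟨ cong (λ t → (sumF N - t) + (sumF N - t)) (sym (ι-* 2 N)) ⟩
        e + e
      ∎
      where open ℚ-Solver

open import Defs
open import Data.Nat using (ℕ; _≤_; _^_; _*_)
open import Data.Nat.Logarithm using (⌊log₂_⌋)
open import Data.Integer using (+_)
open import Data.Rational using (ℚ; _-_; ∣_∣; _/_) renaming (_≤_ to _≤ℚ_)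
open import Data.Product using (Σ; _×_; _,_)
open Estimates using (sumF-error; doubleSum-error; ι-mono-≤)
open import Data.Nat.Properties using (*-monoˡ-≤; m≤m+n)
open import Data.Rational.Properties using (≤-trans)

theorem6 : Σ ℕ (λ C → (N : ℕ) → 2 ≤ N →
    (∣ sumF N - (+ (2 * N)) / 1 ∣ ≤ℚ (+ (C * (⌊log₂ N ⌋ ^ 2))) / 1)
    × (∣ doubleSum N - (+ (3 * N)) / 1 ∣ ≤ℚ (+ (C * (⌊log₂ N ⌋ ^ 2))) / 1))
theorem6 = 20 , λ N 2≤N →
  ≤-trans (sumF-error N 2≤N) (ι-mono-≤ (*-monoˡ-≤ (⌊log₂ N ⌋ ^ 2) {10} {20} (m≤m+n 10 10))) ,
  doubleSum-error N 2≤N
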